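{- Let $A=\{a,a',b,b'\}$ with each attribute taking values in $\{0,1\}$. Consider the relations (sets of pairs of values, first component the value of the first-listed attribute): $R_{\{a,b\}}=\{(0,0),(0,1),(1,0),(1,1)\}$ on attributes $(a,b)$; $R_{\{a',b\}}=\{(0,1),(1,0),(1,1)\}$ on $(a',b)$; $R_{\{a,b'\}}=\{(0,1),(1,0),(1,1)\}$ on $(a,b')$; $R_{\{a',b'\}}=\{(0,0),(0,1),(1,0)\}$ on $(a',b')$. Then there is no set $R$ of functions $A\to\{0,1\}$ such that $R|_{\{\alpha,\beta\}}=R_{\{\alpha,\beta\}}$ for all $\alpha\in\{a,a'\}$, $\beta\in\{b,b'\}$, where $R|_{\{\alpha,\beta\}}=\{t|_{\{\alpha,\beta\}}: t\in R\}$. -}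

module Defs where

open import Data.Bool using (Bool; true; false)
open import Data.Product using (Σ; _×_; ∃-syntax)
open import Relation.Binary.PropositionalEquality using (_≡_)
open import Function.Bundles using (_⇔_)
open import Data.Empty using (⊥)
open import Data.Unit using (⊤)

-- The attribute set A = {a, a', b, b'}; values {0,1} encoded as Bool (false = 0, true = 1).
data Attr : Set where
  a a' b b' : Attr

Tuple : Set
Tuple = Attr → Bool

BinRel : Set₁
BinRel = Bool → Bool → Set

proj : (Tuple → Set) → Attr → Attr → BinRel
proj R α β x y = ∃[ t ] (R t × (t α ≡ x) × (t β ≡ y))

_≐_ : BinRel → BinRel → Set
S ≐ T = ∀ x y → (S x y ⇔ T x y)

R-ab : BinRel
R-ab _ _ = ⊤

R-a'b : BinRel
R-a'b false false = ⊥
R-a'b _ _ = ⊤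

R-ab' : BinRel
R-ab' false false = ⊥
R-ab' _ _ = ⊤

R-a'b' : BinRel
R-a'b' true true = ⊥
R-a'b' _ _ = ⊤

module Submission where

-- The projection onto {a,b} must contain (0,0), so some tuple
-- t ∈ R has t(a) = 0 and t(b) = 0.  Its projections lie in the other three
-- prescribed relations:  (t(a'), 0) ∈ R_{a',b} forces t(a') = 1, and
-- (0, t(b')) ∈ R_{a,b'} forces t(b') = 1; but then (1,1) ∈ R_{a',b'},
-- which that relation excludes.

open import Defs
open import Data.Product using (_×_; _,_)
open import Relation.Nullary using (¬_)
open import Data.Bool using (Bool; true; false)
open import Data.Unit using (tt)
open import Function.Bundles using (Equivalence)
open import Relation.Binary.PropositionalEquality using (_≡_; refl)

R-a'b-second-false : (x : Bool) → R-a'b x false → x ≡ true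
R-a'b-second-false true  _ = refl
R-a'b-second-false false ()

R-ab'-first-false : (y : Bool) → R-ab' false y → y ≡ true
R-ab'-first-false true  _ = refl
R-ab'-first-false false ()

R-a'b'-excludes-11 : ¬ R-a'b' true true
R-a'b'-excludes-11 ()

proposition5 : (R : Tuple → Set) →
    ¬ ((proj R a b ≐ R-ab) × (proj R a' b ≐ R-a'b) × (proj R a b' ≐ R-ab') × (proj R a' b' ≐ R-a'b'))
proposition5 R (eq-ab , eq-a'b , eq-ab' , eq-a'b')
  with Equivalence.from (eq-ab false false) tt
... | t , Rt , ta≡0 , tb≡0 = R-a'b'-excludes-11 t-a'b'∈R-a'b'
  where
  open Equivalence using (to)

  ta'≡1 : t a' ≡ true
  ta'≡1 = R-a'b-second-false (t a') (to (eq-a'b (t a') false) (t , Rt , refl , tb≡0))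

  tb'≡1 : t b' ≡ true
  tb'≡1 = R-ab'-first-false (t b') (to (eq-ab' false (t b')) (t , Rt , ta≡0 , refl))

  t-a'b'∈R-a'b' : R-a'b' true true
  t-a'b'∈R-a'b' = to (eq-a'b' true true) (t , Rt , ta'≡1 , tb'≡1)
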